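{- Let $k\geq 2$ be an integer and $\epsilon>0$. Then there is $C_\epsilon$ such that for all integers $C\geq C_\epsilon$ the following holds: among the integer $k$-tuples $(a_1,\dots,a_k)\in[1,C]^k$, there are at least $(1-\epsilon)C^k$ for which the map $$(i_1,i_2,\dots,i_k)\mapsto i_1a_1+i_2a_2+\cdots+i_ka_k$$ is injective on the set of integer tuples with $1\leq i_1,\dots,i_k\leq C^{1/k-\epsilon}$. Moreover, $C_\epsilon$ can be taken to be $(\epsilon^{ -1}2^k)^{1/(\epsilon k)}$.
   Formalization: The parameter ε ranges over the positive rationals. -}

module Defs where

open import Data.Nat using (ℕ; _+_; _*_; _^_; _≤_)
open import Data.Product using (_×_)
open import Data.Nat.ListAction using (sum)
open import Data.Vec using (Vec; zipWith; toList)
open import Data.Vec.Relation.Unary.All using (All)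
open import Relation.Binary.PropositionalEquality using (_≡_)

dot : ∀ {k} → Vec ℕ k → Vec ℕ k → ℕ
dot a i = sum (toList (zipWith _*_ a i))

InBox : ℕ → ∀ {k} → Vec ℕ k → Set
InBox C a = All (λ x → 1 ≤ x × x ≤ C) a

-- With ε = p / q (p, q > 0), the condition  1 ≤ x ≤ C^(1/k - ε)
-- is, for x ≥ 1 and C ≥ 1, equivalent (raise to the power k·q) to
--   x^(k q) · C^(k p) ≤ C^q .
SmallIndex : (k p q C : ℕ) → ℕ → Set
SmallIndex k p q C x = 1 ≤ x × (x ^ (k * q)) * (C ^ (k * p)) ≤ C ^ q

IndexSet : (k p q C : ℕ) → Vec ℕ k → Set
IndexSet k p q C i = All (SmallIndex k p q C) i

GoodTuple : (k p q C : ℕ) → Vec ℕ k → Set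
GoodTuple k p q C a =
  ∀ (i j : Vec ℕ k) → IndexSet k p q C i → IndexSet k p q C j →
  dot a i ≡ dot a j → i ≡ j

{-# OPTIONS --safe #-}

-- Let M be the largest admissible index, so that all admissible index
-- tuples lie in [1, M]^k; the hypothesis on C gives q (2M)^k ≤ p C.  If
-- a·i = a·j for distinct admissible i and j, then d = i - j is a nonzero
-- integer vector with entries of absolute value below M and d·a = 0.  For
-- a fixed such d, a coordinate where d is nonzero determines that entry of
-- a from the others, so at most C^(k-1) tuples a ∈ [1, C]^k satisfy
-- d·a = 0.  With at most (2M)^k choices of d, at most
-- (2M)^k C^(k-1) ≤ (p/q) C^k tuples are bad.

module Submission where

open import Defs
open import Data.Nat using (ℕ; _+_; _*_; _^_; _≤_; _<_)
open import Data.Product using (_×_; ∃-syntax)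
open import Data.List using (List; length)
open import Data.List.Relation.Unary.All using (All)
open import Data.List.Relation.Unary.Unique.Propositional using (Unique)
open import Data.Vec using (Vec)

open import Level using (Level)
open import Function using (_∘_; id)
open import Data.Sum using (_⊎_; inj₁; inj₂)
open import Data.Product using (_,_; proj₁; swap)
open import Data.Nat using (zero; suc; z≤n; s≤s; _⊔_; _≤?_; NonZero; >-nonZero; >-nonZero⁻¹)
open import Data.Nat.Properties
open import Data.Nat.Tactic.RingSolver as ℕ-Ring using ()
import Data.Integer as ℤ
open ℤ using (ℤ; 0ℤ; +_; ∣_∣; _⊖_)
import Data.Integer.Properties as ℤₚ
open import Data.Integer.Tactic.RingSolver as ℤ-Ring using ()
open import Algebra.Properties.AbelianGroup ℤₚ.+-0-abelianGroup using (∙-cancelʳ)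
open import Data.List using ([]; _∷_; _++_; map; filter; cartesianProductWith; upTo; applyUpTo)
open import Data.List.Properties
  using (length-++; length-map; length-filter; filter-none; filter-accept; length-upTo; length-applyUpTo)
open import Data.List.Extrema.Nat using (max; xs≤max; argmax-all)
import Data.List.Relation.Unary.All as ListAll
open ListAll using ([]; _∷_)
open import Data.List.Relation.Unary.AllPairs using ([]; _∷_)
open import Data.List.Relation.Unary.All.Properties using (all-filter)
open import Data.List.Relation.Unary.Any using (Any; here; any?; toSum)
import Data.List.Relation.Unary.Unique.Propositional.Properties as Unique
open import Data.List.Membership.Propositional using (_∈_; lose)
open import Data.List.Membership.Propositional.Properties
  using (∈-map⁺; ∈-++⁺ˡ; ∈-++⁺ʳ; ∈-upTo⁺; ∈-applyUpTo⁻; ∈-filter⁺; ∈-filter⁻;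
         ∈-cartesianProductWith⁺; ∈-cartesianProductWith⁻)
open import Data.Vec using ([]; _∷_; zipWith)
open import Data.Vec.Properties using (∷-injective)
import Data.Vec.Relation.Unary.All as VecAll
open VecAll using ([]; _∷_)
open import Relation.Binary.PropositionalEquality
open import Relation.Nullary using (¬_; yes; no; ¬?; contradiction; _×-dec_)
open import Relation.Unary using (Pred; Decidable)
open import Relation.Unary.Properties using (∁?)

private
  variable
    a c p q r : Level
    A B D : Set a
    k : ℕ

count : {P : Pred A p} → Decidable P → List A → ℕ
count P? xs = length (filter P? xs)

module _ {P : Pred A p} (P? : Decidable P) where

  count-++ : ∀ xs ys → count P? (xs ++ ys) ≡ count P? xs + count P? ys
  count-++ []       ys = refl
  count-++ (x ∷ xs) ys with P? x
  ... | yes _ = cong suc (count-++ xs ys)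
  ... | no  _ = count-++ xs ys

  count-map : (f : B → A) → ∀ xs → count P? (map f xs) ≡ count (P? ∘ f) xs
  count-map f []       = refl
  count-map f (x ∷ xs) with P? (f x)
  ... | yes _ = cong suc (count-map f xs)
  ... | no  _ = count-map f xs

  count-∷-≥ : ∀ x xs → count P? xs ≤ count P? (x ∷ xs)
  count-∷-≥ x xs with P? x
  ... | yes _ = n≤1+n _
  ... | no  _ = ≤-refl

  count-accept : ∀ {x xs} → P x → count P? (x ∷ xs) ≡ suc (count P? xs)
  count-accept px = cong length (filter-accept P? px)

  count-none : (∀ x → ¬ P x) → ∀ xs → count P? xs ≡ 0
  count-none ¬P xs = cong length (filter-none P? (ListAll.universal ¬P xs))

  count-complement : ∀ xs → count P? xs + count (∁? P?) xs ≡ length xs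
  count-complement []       = refl
  count-complement (x ∷ xs) with P? x
  ... | yes _ = cong suc (count-complement xs)
  ... | no  _ = trans (+-suc _ _) (cong suc (count-complement xs))

  count-∁-≥ : ∀ xs {m n N} → length xs ≡ N → n * count P? xs ≤ m * N →
              n * N ≤ n * count (∁? P?) xs + m * N
  count-∁-≥ xs {m} {n} refl bound = begin
    n * length xs                                ≡⟨ cong (n *_) (count-complement xs) ⟨
    n * (count P? xs + count (∁? P?) xs)         ≡⟨ *-distribˡ-+ n (count P? xs) _ ⟩
    n * count P? xs + n * count (∁? P?) xs       ≤⟨ +-monoˡ-≤ _ bound ⟩
    m * length xs + n * count (∁? P?) xs         ≡⟨ +-comm (m * length xs) _ ⟩
    n * count (∁? P?) xs + m * length xs ∎
    where open ≤-Reasoning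

  count-≤-1 : ∀ {xs} → Unique xs → (∀ {x y} → P x → P y → x ≡ y) → count P? xs ≤ 1
  count-≤-1 {xs} unique P-unique = length-≤-1 (Unique.filter⁺ P? unique) (all-filter P? xs)
    where
    length-≤-1 : ∀ {ys} → Unique ys → All P ys → length ys ≤ 1
    length-≤-1 {[]}         _                 _                 = z≤n
    length-≤-1 {_ ∷ []}     _                 _                 = s≤s z≤n
    length-≤-1 {_ ∷ _ ∷ _} ((y≢y′ ∷ _) ∷ _) (py ∷ py′ ∷ _) = contradiction (P-unique py py′) y≢y′

count-⊆-∪ : {R : Pred A r} {P : Pred A p} {Q : Pred A q}
            (R? : Decidable R) (P? : Decidable P) (Q? : Decidable Q) →
            (∀ {x} → R x → P x ⊎ Q x) → ∀ xs → count R? xs ≤ count P? xs + count Q? xs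
count-⊆-∪ R? P? Q? R⊆P∪Q []       = z≤n
count-⊆-∪ R? P? Q? R⊆P∪Q (x ∷ xs) with ih ← count-⊆-∪ R? P? Q? R⊆P∪Q xs | R? x
... | no _  = ≤-trans ih (+-mono-≤ (count-∷-≥ P? x xs) (count-∷-≥ Q? x xs))
... | yes r with R⊆P∪Q r
...   | inj₁ px = begin
  suc (count R? xs)               ≤⟨ s≤s ih ⟩
  suc (count P? xs) + count Q? xs ≤⟨ +-mono-≤ (≤-reflexive (sym (count-accept P? px))) (count-∷-≥ Q? x xs) ⟩
  count P? (x ∷ xs) + count Q? (x ∷ xs) ∎
  where open ≤-Reasoning
...   | inj₂ qx = begin
  suc (count R? xs)               ≤⟨ s≤s ih ⟩
  suc (count P? xs + count Q? xs) ≡⟨ +-suc (count P? xs) (count Q? xs) ⟨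
  count P? xs + suc (count Q? xs) ≤⟨ +-mono-≤ (count-∷-≥ P? x xs) (≤-reflexive (sym (count-accept Q? qx))) ⟩
  count P? (x ∷ xs) + count Q? (x ∷ xs) ∎
  where open ≤-Reasoning

count-any-≤ : {P : B → Pred A p} (P? : ∀ d → Decidable (P d)) (ds : List B) {xs : List A} {n : ℕ} →
              All (λ d → count (P? d) xs ≤ n) ds →
              count (λ x → any? (λ d → P? d x) ds) xs ≤ length ds * n
count-any-≤ P? []       {xs} []         = ≤-reflexive (count-none _ (λ _ ()) xs)
count-any-≤ P? (d ∷ ds) {xs} (bd ∷ bds) =
  ≤-trans (count-⊆-∪ _ (P? d) (λ x → any? (λ d → P? d x) ds) toSum xs)
          (+-mono-≤ bd (count-any-≤ P? ds {xs} bds))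

module _ (f : B → D → A) {P : Pred A p} (P? : Decidable P) {ys : List D} where

  count-cartesianProductWith-∷ : ∀ v vs → count P? (cartesianProductWith f (v ∷ vs) ys) ≡
                                          count (P? ∘ f v) ys + count P? (cartesianProductWith f vs ys)
  count-cartesianProductWith-∷ v vs =
    trans (count-++ P? (map (f v) ys) _) (cong (_+ _) (count-map P? (f v) ys))

  count-cartesianProductWith-≤ : ∀ {n} → (∀ v → count (P? ∘ f v) ys ≤ n) →
                                 ∀ vs → count P? (cartesianProductWith f vs ys) ≤ length vs * n
  count-cartesianProductWith-≤ bound []       = z≤n
  count-cartesianProductWith-≤ bound (v ∷ vs) =
    ≤-trans (≤-reflexive (count-cartesianProductWith-∷ v vs))
            (+-mono-≤ (bound v) (count-cartesianProductWith-≤ bound vs))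

  count-cartesianProductWith-≤-count : {Q : Pred B c} (Q? : Decidable Q) → (∀ {v y} → P (f v y) → Q v) →
                                       ∀ vs → count P? (cartesianProductWith f vs ys) ≤ count Q? vs * length ys
  count-cartesianProductWith-≤-count Q? P⇒Q []       = z≤n
  count-cartesianProductWith-≤-count Q? P⇒Q (v ∷ vs) with Q? v
  ... | yes _ = ≤-trans (≤-reflexive (count-cartesianProductWith-∷ v vs))
                        (+-mono-≤ (length-filter (P? ∘ f v) ys) (count-cartesianProductWith-≤-count Q? P⇒Q vs))
  ... | no ¬q = ≤-trans (≤-reflexive (trans (count-cartesianProductWith-∷ v vs)
                                            (cong (_+ _) (count-none (P? ∘ f v) (λ _ → ¬q ∘ P⇒Q) ys))))
                        (count-cartesianProductWith-≤-count Q? P⇒Q vs)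

length-cartesianProductWith : (f : A → B → D) (xs : List A) (ys : List B) →
                              length (cartesianProductWith f xs ys) ≡ length xs * length ys
length-cartesianProductWith f []       ys = refl
length-cartesianProductWith f (x ∷ xs) ys = begin
  length (map (f x) ys ++ cartesianProductWith f xs ys)        ≡⟨ length-++ (map (f x) ys) ⟩
  length (map (f x) ys) + length (cartesianProductWith f xs ys) ≡⟨ cong₂ _+_ (length-map (f x) ys)
                                                                          (length-cartesianProductWith f xs ys) ⟩
  length ys + length xs * length ys ∎
  where open ≡-Reasoning

-- The tail varies in the outer loop and the head in the inner one.
vecs : List A → (k : ℕ) → List (Vec A k)
vecs xs zero    = [] ∷ []
vecs xs (suc k) = cartesianProductWith (λ v x → x ∷ v) (vecs xs k) xs

length-vecs : (xs : List A) (k : ℕ) → length (vecs xs k) ≡ length xs ^ k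
length-vecs xs zero    = refl
length-vecs xs (suc k) = begin
  length (vecs xs (suc k))        ≡⟨ length-cartesianProductWith _ (vecs xs k) xs ⟩
  length (vecs xs k) * length xs  ≡⟨ cong (_* length xs) (length-vecs xs k) ⟩
  length xs ^ k * length xs       ≡⟨ *-comm _ (length xs) ⟩
  length xs ^ suc k ∎
  where open ≡-Reasoning

vecs-unique : {xs : List A} → Unique xs → (k : ℕ) → Unique (vecs xs k)
vecs-unique u zero    = [] ∷ []
vecs-unique u (suc k) = Unique.cartesianProductWith⁺ _ (swap ∘ ∷-injective) (vecs-unique u k) u

∈-vecs⁺ : {xs : List A} {v : Vec A k} → VecAll.All (_∈ xs) v → v ∈ vecs xs k
∈-vecs⁺ []         = here refl
∈-vecs⁺ (x∈ ∷ v∈) = ∈-cartesianProductWith⁺ _ (∈-vecs⁺ v∈) x∈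

∈-vecs⁻ : (xs : List A) {v : Vec A k} → v ∈ vecs xs k → VecAll.All (_∈ xs) v
∈-vecs⁻ {k = zero}  xs {[]} _  = []
∈-vecs⁻ {k = suc k} xs v∈ with ∈-cartesianProductWith⁻ _ (vecs xs k) xs v∈
... | _ , _ , w∈ , x∈ , refl = x∈ ∷ ∈-vecs⁻ xs w∈

_·_ : Vec ℤ k → Vec ℕ k → ℤ
[]      · []      = 0ℤ
(c ∷ d) · (x ∷ a) = c ℤ.* + x ℤ.+ d · a

Orthogonal : Vec ℤ k → Pred (Vec ℕ k) _
Orthogonal d a = d · a ≡ 0ℤ

orthogonal? : (d : Vec ℤ k) → Decidable (Orthogonal d)
orthogonal? d a = d · a ℤ.≟ 0ℤ

Nontrivial : Pred (Vec ℤ k) _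
Nontrivial d = ¬ VecAll.All (_≡ 0ℤ) d

nontrivial? : Decidable (Nontrivial {k})
nontrivial? d = ¬? (VecAll.all? (ℤ._≟ 0ℤ) d)

orthogonal-tail : ∀ {d : Vec ℤ k} {x a} → Orthogonal (0ℤ ∷ d) (x ∷ a) → Orthogonal d a
orthogonal-tail {d = d} {x} {a} d·a≡0 = begin
  d · a                   ≡⟨ ℤₚ.+-identityˡ (d · a) ⟨
  0ℤ ℤ.+ d · a            ≡⟨ cong (ℤ._+ d · a) (ℤₚ.*-zeroˡ (+ x)) ⟨
  0ℤ ℤ.* + x ℤ.+ d · a    ≡⟨ d·a≡0 ⟩
  0ℤ ∎
  where open ≡-Reasoning

orthogonal-head-unique : ∀ {c} {d : Vec ℤ k} {a x y} → c ≢ 0ℤ →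
                         Orthogonal (c ∷ d) (x ∷ a) → Orthogonal (c ∷ d) (y ∷ a) → x ≡ y
orthogonal-head-unique {c = c} {d} {a} {x} {y} c≢0 x⊥ y⊥ =
  ℤₚ.+-injective (ℤₚ.*-cancelˡ-≡ c (+ x) (+ y) {{ℤ.≢-nonZero c≢0}}
    (∙-cancelʳ (d · a) (c ℤ.* + x) (c ℤ.* + y) (trans x⊥ (sym y⊥))))

-- A nonzero relation vector determines one entry of an orthogonal tuple
-- from the others.
count-orthogonal : {R : List ℕ} → Unique R → (d : Vec ℤ (suc k)) → Nontrivial d →
                   count (orthogonal? d) (vecs R (suc k)) ≤ length R ^ k
count-orthogonal {k} {R} uR (c ∷ d) d≢0 with c ℤ.≟ 0ℤ
... | no c≢0 = begin
  count (orthogonal? (c ∷ d)) (vecs R (suc k))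
    ≤⟨ count-cartesianProductWith-≤ _ (orthogonal? (c ∷ d)) (λ v →
         count-≤-1 (orthogonal? (c ∷ d) ∘ (_∷ v)) uR (orthogonal-head-unique {d = d} {v} c≢0))
         (vecs R k) ⟩
  length (vecs R k) * 1 ≡⟨ trans (*-identityʳ _) (length-vecs R k) ⟩
  length R ^ k ∎
  where open ≤-Reasoning
count-orthogonal {zero}  {R} uR (c ∷ []) d≢0 | yes refl = contradiction (refl ∷ []) d≢0
count-orthogonal {suc k} {R} uR (c ∷ d)  d≢0 | yes refl = begin
  count (orthogonal? (0ℤ ∷ d)) (vecs R (suc (suc k)))
    ≤⟨ count-cartesianProductWith-≤-count _ (orthogonal? (0ℤ ∷ d)) (orthogonal? d)
         (λ {v} {x} → orthogonal-tail {d = d} {x} {v}) (vecs R (suc k)) ⟩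
  count (orthogonal? d) (vecs R (suc k)) * length R
    ≤⟨ *-monoˡ-≤ (length R) (count-orthogonal uR d (d≢0 ∘ (refl ∷_))) ⟩
  length R ^ k * length R ≡⟨ *-comm _ (length R) ⟩
  length R ^ suc k ∎
  where open ≤-Reasoning

diff : Vec ℕ k → Vec ℕ k → Vec ℤ k
diff = zipWith (λ x y → + x ℤ.- + y)

·-diff : (i j a : Vec ℕ k) → diff i j · a ≡ + dot a i ℤ.- + dot a j
·-diff []      []      []      = refl
·-diff (y ∷ i) (z ∷ j) (x ∷ a) = begin
  (+ y ℤ.- + z) ℤ.* + x ℤ.+ diff i j · a
    ≡⟨ cong (λ r → (+ y ℤ.- + z) ℤ.* + x ℤ.+ r) (·-diff i j a) ⟩
  (+ y ℤ.- + z) ℤ.* + x ℤ.+ (+ dot a i ℤ.- + dot a j)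
    ≡⟨ rearrange (+ x) (+ y) (+ z) (+ dot a i) (+ dot a j) ⟩
  (+ x ℤ.* + y ℤ.+ + dot a i) ℤ.- (+ x ℤ.* + z ℤ.+ + dot a j)
    ≡⟨ sym (cong₂ ℤ._-_ (pos-affine x y (dot a i)) (pos-affine x z (dot a j))) ⟩
  + (x * y + dot a i) ℤ.- + (x * z + dot a j) ∎
  where
  open ≡-Reasoning
  rearrange : ∀ x y z m n → (y ℤ.- z) ℤ.* x ℤ.+ (m ℤ.- n) ≡ (x ℤ.* y ℤ.+ m) ℤ.- (x ℤ.* z ℤ.+ n)
  rearrange = ℤ-Ring.solve-∀
  pos-affine : ∀ x y n → + (x * y + n) ≡ + x ℤ.* + y ℤ.+ + n
  pos-affine x y n = trans (ℤₚ.pos-+ (x * y) n) (cong (ℤ._+ + n) (ℤₚ.pos-* x y))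

diff-zero : (i j : Vec ℕ k) → VecAll.All (_≡ 0ℤ) (diff i j) → i ≡ j
diff-zero []      []      []       = refl
diff-zero (x ∷ i) (y ∷ j) (e ∷ es) =
  cong₂ _∷_ (ℤₚ.+-injective (ℤₚ.i-j≡0⇒i≡j (+ x) (+ y) e)) (diff-zero i j es)

-- Zero occurs twice.
smallIntegers : ℕ → List ℤ
smallIntegers M = map +_ (upTo M) ++ map (ℤ.-_ ∘ +_) (upTo M)

length-smallIntegers : ∀ M → length (smallIntegers M) ≡ M + M
length-smallIntegers M = begin
  length (smallIntegers M)                                    ≡⟨ length-++ (map +_ (upTo M)) ⟩
  length (map +_ (upTo M)) + length (map (ℤ.-_ ∘ +_) (upTo M)) ≡⟨ cong₂ _+_ (length-map _ (upTo M))
                                                                            (length-map _ (upTo M)) ⟩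
  length (upTo M) + length (upTo M)                            ≡⟨ cong₂ _+_ (length-upTo M) (length-upTo M) ⟩
  M + M ∎
  where open ≡-Reasoning

∈-smallIntegers⁺ : ∀ {M} z → ∣ z ∣ < M → z ∈ smallIntegers M
∈-smallIntegers⁺ (+ n)      n<M = ∈-++⁺ˡ (∈-map⁺ +_ (∈-upTo⁺ n<M))
∈-smallIntegers⁺ ℤ.-[1+ n ] n<M = ∈-++⁺ʳ (map +_ (upTo _)) (∈-map⁺ (ℤ.-_ ∘ +_) (∈-upTo⁺ n<M))

∣[+m]-[+n]∣<o : ∀ {M x y} → 1 ≤ x × x ≤ M → 1 ≤ y × y ≤ M → ∣ + x ℤ.- + y ∣ < M
∣[+m]-[+n]∣<o {M} {suc x} {suc y} (_ , x<M) (_ , y<M) = begin-strict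
  ∣ + suc x ℤ.- + suc y ∣ ≡⟨ cong ∣_∣ (ℤₚ.[+m]-[+n]≡m⊖n (suc x) (suc y)) ⟩
  ∣ suc x ⊖ suc y ∣       ≡⟨ cong ∣_∣ (ℤₚ.[1+m]⊖[1+n]≡m⊖n x y) ⟩
  ∣ x ⊖ y ∣               ≤⟨ ℤₚ.∣m⊝n∣≤m⊔n x y ⟩
  x ⊔ y                   <⟨ ⊔-lub x<M y<M ⟩
  M ∎
  where open ≤-Reasoning

diff-∈-vecs : ∀ {M} {i j : Vec ℕ k} → InBox M i → InBox M j → diff i j ∈ vecs (smallIntegers M) k
diff-∈-vecs bi bj = ∈-vecs⁺ (entries bi bj)
  where
  entries : ∀ {M k} {i j : Vec ℕ k} → InBox M i → InBox M j → VecAll.All (_∈ smallIntegers M) (diff i j)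
  entries []         []         = []
  entries (bx ∷ bi) (by ∷ bj) = ∈-smallIntegers⁺ _ (∣[+m]-[+n]∣<o bx by) ∷ entries bi bj

smallRelations : ℕ → (k : ℕ) → List (Vec ℤ k)
smallRelations M k = filter nontrivial? (vecs (smallIntegers M) k)

HasSmallRelation : ℕ → Pred (Vec ℕ k) _
HasSmallRelation M a = Any (λ d → Orthogonal d a) (smallRelations M _)

hasSmallRelation? : (M : ℕ) → Decidable (HasSmallRelation {k} M)
hasSmallRelation? M a = any? (λ d → orthogonal? d a) (smallRelations M _)

noSmallRelation⇒injective : ∀ {M} {a i j : Vec ℕ k} → ¬ HasSmallRelation M a →
                            InBox M i → InBox M j → dot a i ≡ dot a j → i ≡ j
noSmallRelation⇒injective {a = a} {i} {j} ¬rel bi bj eq with VecAll.all? (ℤ._≟ 0ℤ) (diff i j)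
... | yes d≡0 = diff-zero i j d≡0
... | no  d≢0 = contradiction (lose (∈-filter⁺ nontrivial? (diff-∈-vecs bi bj) d≢0) orthogonal) ¬rel
  where
  orthogonal : Orthogonal (diff i j) a
  orthogonal = begin
    diff i j · a              ≡⟨ ·-diff i j a ⟩
    + dot a i ℤ.- + dot a j   ≡⟨ cong (λ n → + n ℤ.- + dot a j) eq ⟩
    + dot a j ℤ.- + dot a j   ≡⟨ ℤₚ.+-inverseʳ (+ dot a j) ⟩
    0ℤ ∎
    where open ≡-Reasoning

count-hasSmallRelation : ∀ M {R : List ℕ} → Unique R →
  count (hasSmallRelation? M) (vecs R (suc k)) ≤ (M + M) ^ suc k * length R ^ k
count-hasSmallRelation {k} M {R} uR = begin
  count (hasSmallRelation? M) (vecs R (suc k))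
    ≤⟨ count-any-≤ orthogonal? (smallRelations M (suc k)) {vecs R (suc k)}
         (ListAll.map (count-orthogonal uR _)
                      (all-filter nontrivial? (vecs (smallIntegers M) (suc k)))) ⟩
  length (smallRelations M (suc k)) * length R ^ k
    ≤⟨ *-monoˡ-≤ _ (length-filter nontrivial? (vecs (smallIntegers M) (suc k))) ⟩
  length (vecs (smallIntegers M) (suc k)) * length R ^ k
    ≡⟨ cong (_* length R ^ k) (trans (length-vecs _ (suc k)) (cong (_^ suc k) (length-smallIntegers M))) ⟩
  (M + M) ^ suc k * length R ^ k ∎
  where open ≤-Reasoning

^-distrib-* : ∀ m n o → (m * n) ^ o ≡ m ^ o * n ^ o
^-distrib-* m n zero    = refl
^-distrib-* m n (suc o) = begin
  m * n * (m * n) ^ o      ≡⟨ cong (m * n *_) (^-distrib-* m n o) ⟩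
  m * n * (m ^ o * n ^ o)  ≡⟨ interchange m n (m ^ o) (n ^ o) ⟩
  m * m ^ o * (n * n ^ o) ∎
  where
  open ≡-Reasoning
  interchange : ∀ a b c d → a * b * (c * d) ≡ a * c * (b * d)
  interchange = ℕ-Ring.solve-∀

^-cancelˡ-≤ : ∀ n .{{_ : NonZero n}} {x y} → x ^ n ≤ y ^ n → x ≤ y
^-cancelˡ-≤ n xⁿ≤yⁿ = ≮⇒≥ (λ y<x → <⇒≱ (^-monoˡ-< n y<x) xⁿ≤yⁿ)

-- Raising to the power q turns the bound into the product of the two hypotheses.
smallIndex⇒q[2x]^k≤pC : ∀ k p q C .{{_ : NonZero q}} → (q * 2 ^ k) ^ q ≤ p ^ q * C ^ (p * k) →
                        ∀ {x} → SmallIndex k p q C x → q * (x + x) ^ k ≤ p * C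
smallIndex⇒q[2x]^k≤pC k p q C hyp {x} (_ , small) = ^-cancelˡ-≤ q (begin
  (q * (x + x) ^ k) ^ q               ≡⟨ cong (λ y → (q * (x + y) ^ k) ^ q) (sym (+-identityʳ x)) ⟩
  (q * (2 * x) ^ k) ^ q               ≡⟨ cong (λ y → (q * y) ^ q) (^-distrib-* 2 x k) ⟩
  (q * (2 ^ k * x ^ k)) ^ q           ≡⟨ cong (_^ q) (sym (*-assoc q (2 ^ k) (x ^ k))) ⟩
  (q * 2 ^ k * x ^ k) ^ q             ≡⟨ ^-distrib-* (q * 2 ^ k) (x ^ k) q ⟩
  (q * 2 ^ k) ^ q * (x ^ k) ^ q       ≡⟨ cong ((q * 2 ^ k) ^ q *_) (^-*-assoc x k q) ⟩
  (q * 2 ^ k) ^ q * x ^ (k * q)       ≤⟨ *-monoˡ-≤ _ hyp ⟩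
  p ^ q * C ^ (p * k) * x ^ (k * q)   ≡⟨ rearrange (p ^ q) (C ^ (p * k)) (x ^ (k * q)) ⟩
  p ^ q * (x ^ (k * q) * C ^ (p * k)) ≡⟨ cong (λ e → p ^ q * (x ^ (k * q) * C ^ e)) (*-comm p k) ⟩
  p ^ q * (x ^ (k * q) * C ^ (k * p)) ≤⟨ *-monoʳ-≤ (p ^ q) small ⟩
  p ^ q * C ^ q                       ≡⟨ sym (^-distrib-* p C q) ⟩
  (p * C) ^ q ∎)
  where
  open ≤-Reasoning
  rearrange : ∀ a b c → a * b * c ≡ a * (c * b)
  rearrange = ℕ-Ring.solve-∀

threshold⇒0<C : ∀ k p q C .{{q≢0 : NonZero q}} → 0 < k → 0 < p →
                (q * 2 ^ k) ^ q ≤ p ^ q * C ^ (p * k) → 0 < C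
threshold⇒0<C (suc k) (suc p) q zero {{q≢0}} _ _ hyp =
  <-≤-trans (m^n>0 (q * 2 ^ suc k) {{m*n≢0 q (2 ^ suc k) {{q≢0}} {{m^n≢0 2 (suc k)}}}} q)
            (≤-trans hyp (≤-reflexive (*-zeroʳ (suc p ^ q))))
threshold⇒0<C _ _ _ (suc C) _ _ _ = s≤s z≤n

smallIndex⇒≤C^q : ∀ k p q C .{{_ : NonZero q}} → 0 < k → 0 < C →
                  ∀ {x} → SmallIndex k p q C x → x ≤ C ^ q
smallIndex⇒≤C^q (suc k) p q C _ 0<C {x} (1≤x , small) = begin
  x                           ≡⟨ ^-identityʳ x ⟨
  x ^ 1                       ≤⟨ ^-monoʳ-≤ x {{>-nonZero 1≤x}} (*-mono-≤ {1} {suc k} (s≤s z≤n) (>-nonZero⁻¹ q)) ⟩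
  x ^ (suc k * q)             ≤⟨ m≤m*n _ _ {{m^n≢0 C (suc k * p) {{>-nonZero 0<C}}}} ⟩
  x ^ (suc k * q) * C ^ (suc k * p) ≤⟨ small ⟩
  C ^ q ∎
  where open ≤-Reasoning

smallIndex? : (k p q C : ℕ) → Decidable (SmallIndex k p q C)
smallIndex? k p q C x = (1 ≤? x) ×-dec (x ^ (k * q) * C ^ (k * p) ≤? C ^ q)

smallIndices : (k p q C : ℕ) → List ℕ
smallIndices k p q C = filter (smallIndex? k p q C) (upTo (suc (C ^ q)))

largestSmallIndex : (k p q C : ℕ) → ℕ
largestSmallIndex k p q C = max 0 (smallIndices k p q C)

smallIndex⇒≤largest : ∀ k p q C .{{_ : NonZero q}} → 0 < k → 0 < C →
                      ∀ {x} → SmallIndex k p q C x → x ≤ largestSmallIndex k p q C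
smallIndex⇒≤largest k p q C 0<k 0<C small =
  ListAll.lookup (xs≤max 0 _)
    (∈-filter⁺ (smallIndex? k p q C)
               (∈-upTo⁺ (s≤s (smallIndex⇒≤C^q k p q C 0<k 0<C small))) small)

largestSmallIndex-bound : ∀ k p q C .{{_ : NonZero q}} → (q * 2 ^ suc k) ^ q ≤ p ^ q * C ^ (p * suc k) →
                          let M = largestSmallIndex (suc k) p q C in q * (M + M) ^ suc k ≤ p * C
largestSmallIndex-bound k p q C hyp =
  argmax-all id {P = λ x → q * (x + x) ^ suc k ≤ p * C} {0} {smallIndices (suc k) p q C}
    (≤-trans (≤-reflexive (*-zeroʳ q)) z≤n)
    (ListAll.map (smallIndex⇒q[2x]^k≤pC (suc k) p q C hyp)
                 (all-filter (smallIndex? (suc k) p q C) (upTo (suc (C ^ q)))))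

oneTo : ℕ → List ℕ
oneTo = applyUpTo suc

oneTo-unique : ∀ C → Unique (oneTo C)
oneTo-unique C = Unique.applyUpTo⁺₁ suc C (λ i<j _ → <⇒≢ i<j ∘ suc-injective)

∈-oneTo⁻ : ∀ {C x} → x ∈ oneTo C → 1 ≤ x × x ≤ C
∈-oneTo⁻ x∈ with ∈-applyUpTo⁻ suc x∈
... | _ , i<C , refl = s≤s z≤n , i<C

fewTuplesWithSmallRelation : ∀ k M p q C → q * (M + M) ^ suc k ≤ p * C →
  q * count (hasSmallRelation? M) (vecs (oneTo C) (suc k)) ≤ p * C ^ suc k
fewTuplesWithSmallRelation k M p q C q[2M]^k≤pC = begin
  q * count (hasSmallRelation? M) (vecs (oneTo C) (suc k))
    ≤⟨ *-monoʳ-≤ q (count-hasSmallRelation {k} M (oneTo-unique C)) ⟩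
  q * ((M + M) ^ suc k * length (oneTo C) ^ k)
    ≡⟨ cong (λ n → q * ((M + M) ^ suc k * n ^ k)) (length-applyUpTo suc C) ⟩
  q * ((M + M) ^ suc k * C ^ k)  ≡⟨ *-assoc q _ _ ⟨
  q * (M + M) ^ suc k * C ^ k    ≤⟨ *-monoˡ-≤ (C ^ k) q[2M]^k≤pC ⟩
  p * C * C ^ k                  ≡⟨ *-assoc p C (C ^ k) ⟩
  p * C ^ suc k ∎
  where open ≤-Reasoning

lemma8 : (k : ℕ) → 2 ≤ k → (p q : ℕ) → 0 < p → 0 < q →
           (C : ℕ) → (q * 2 ^ k) ^ q ≤ p ^ q * C ^ (p * k) →
           ∃[ L ] (Unique {A = Vec ℕ k} L
                   × All (λ a → InBox C a × GoodTuple k p q C a) L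
                   × q * C ^ k ≤ q * length L + p * C ^ k)
lemma8 (suc k) _ p q@(suc _) 0<p _ C hyp =
  L , Unique.filter⁺ _ (vecs-unique (oneTo-unique C) (suc k)) , ListAll.tabulate good ,
  count-∁-≥ (hasSmallRelation? M) tuples {p} {q} length-tuples
    (fewTuplesWithSmallRelation k M p q C (largestSmallIndex-bound k p q C hyp))
  where
  0<C : 0 < C
  0<C = threshold⇒0<C (suc k) p q C (s≤s z≤n) 0<p hyp

  M : ℕ
  M = largestSmallIndex (suc k) p q C

  tuples L : List (Vec ℕ (suc k))
  tuples = vecs (oneTo C) (suc k)
  L = filter (∁? (hasSmallRelation? M)) tuples

  length-tuples : length tuples ≡ C ^ suc k
  length-tuples = trans (length-vecs (oneTo C) (suc k)) (cong (_^ suc k) (length-applyUpTo suc C))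

  inBox : ∀ {i} → IndexSet (suc k) p q C i → InBox M i
  inBox = VecAll.map (λ small → proj₁ small , smallIndex⇒≤largest (suc k) p q C (s≤s z≤n) 0<C small)

  good : ∀ {a} → a ∈ L → InBox C a × GoodTuple (suc k) p q C a
  good a∈L with a∈tuples , ¬rel ← ∈-filter⁻ (∁? (hasSmallRelation? M)) a∈L =
    VecAll.map ∈-oneTo⁻ (∈-vecs⁻ _ a∈tuples) ,
    λ i j si sj → noSmallRelation⇒injective ¬rel (inBox si) (inBox sj)
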